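{- Assume the setting described in the context. If $G$ has no even hole and a set $Y$ exists, then the bi-tree $T=(V,A,E)$ has no obstruction directed to any vertex and no alternating obstruction.
   Context: Setting: $k\ge1$ is an integer and $G$ is a finite simple graph whose vertex set is partitioned into $k+1$ cliques $X_1,\dots,X_{k+1}$ (called parts) and a set $W$ of $k$ vertices $w_{a_1b_1},\dots,w_{a_kb_k}$ with $a_i\ne b_i\in\{1,\dots,k+1\}$; $W$ is an independent set. Each $w_{a_ib_i}$ is adjacent to every vertex of $X_{a_i}$ and of $X_{b_i}$ and to no vertex of any other part. The set of pairs $E=\{\{a_i,b_i\}:1\le i\le k\}$ forms a tree (the white tree) on $V=\{1,\dots,k+1\}$ in which $k+1$ is a leaf. For each $1\le i\le k$ the part $X_i$ contains a distinguished vertex $x_i$, and $\{x_1,\dots,x_k\}$ is an independent set. For each $1\le i\le k$ there is $r(i)\in V$, $r(i)\ne i$, such that $x_i$ is adjacent to every vertex of $X_{r(i)}\setminus\{x_{r(i)}\}$ (which is $X_{k+1}$ if $r(i)=k+1$), and $x_i$ has no neighbour in $X_j$ for every $j\notin\{i,r(i)\}$. The set of ordered pairs $A=\{(i,r(i)):1\le i\le k\}$ forms an in-arborescence (the red in-arborescence) on $V$ rooted at $k+1$ (every vertex other than $k+1$ has out-degree one). Then $T=(V,A,E)$ is a bi-tree. A set $Y$ is an independent set $\{y_1,\dots,y_{k+1}\}$ of $G$ with $y_i\in X_i$ for all $i$ and $y_i\ne x_i$ for $i\le k$. A hole is a chordless cycle on at least four vertices; it is even if it has an even number of vertices. White paths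 are paths in $(V,E)$, directed red paths are directed paths in $(V,A)$. An obstruction directed to $v$: three distinct vertices $a,b,v\in V$, a white path from $a$ to $b$ of length one or two, a directed red path from $a$ to $v$ of length at least one, and a directed red path from $b$ to $v$ of length at least one, the three paths being internally vertex disjoint. An alternating obstruction: four distinct vertices $a,b,c,d\in V$, a white path from $a$ to $b$, a directed red path between $b$ and $c$ (directed either way), a white path from $c$ to $d$, and a directed red path between $d$ and $a$ (directed either way), with at least one of the two white paths of length exactly one and the four paths internally vertex disjoint. -}

module Defs where

open import Data.Nat using (ℕ; zero; suc; _+_; _*_; _∸_; _≤_)
open import Data.Fin using (Fin; toℕ; inject₁; fromℕ)
open import Data.List using (List; length; head; last)
open import Data.List.Relation.Unary.Linked using (Linked)
open import Data.List.Relation.Unary.Unique.Propositional using (Unique)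
open import Data.List.Membership.Propositional using (_∈_)
open import Data.Maybe using (just)
open import Data.Product using (Σ; ∃; _×_; _,_)
open import Data.Sum using (_⊎_; inj₁; inj₂)
open import Data.Empty using (⊥)
open import Relation.Nullary using (¬_)
open import Relation.Binary.PropositionalEquality using (_≡_; _≢_)
open import Function.Definitions using (Injective)

IsPath : {V : Set} → (V → V → Set) → V → V → List V → Set
IsPath R s t vs = Linked R vs × Unique vs × head vs ≡ just s × last vs ≡ just t

len : {V : Set} → List V → ℕ
len vs = length vs ∸ 1

IntDisj : {V : Set} → List V → V → V → List V → V → V → Set
IntDisj vs s t ws s' t' =
  ∀ x → x ∈ vs → x ∈ ws → (x ≡ s ⊎ x ≡ t) × (x ≡ s' ⊎ x ≡ t')

Even : ℕ → Set
Even m = Σ ℕ λ t → m ≡ 2 * t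

CycAdj : (m : ℕ) → Fin m → Fin m → Set
CycAdj m i j =
  toℕ j ≡ suc (toℕ i) ⊎ toℕ i ≡ suc (toℕ j)
  ⊎ (toℕ i ≡ 0 × suc (toℕ j) ≡ m) ⊎ (toℕ j ≡ 0 × suc (toℕ i) ≡ m)

IsHole : {Vt : Set} → (Vt → Vt → Set) → (m : ℕ) → (Fin m → Vt) → Set
IsHole Adj m f =
  4 ≤ m × Injective _≡_ _≡_ f
  × (∀ i j → Adj (f i) (f j) → CycAdj m i j)
  × (∀ i j → CycAdj m i j → Adj (f i) (f j))

NoEvenHole : {Vt : Set} → (Vt → Vt → Set) → Set
NoEvenHole Adj = ∀ m f → IsHole Adj m f → ¬ Even m

-- Tree vertices V = Fin (suc k): index p stands for vertex p+1, so
-- 1..k are `inject₁ i` (i : Fin k) and k+1 is `fromℕ k`.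
-- Vertices of G: (inj₁ (p , u)) is the u-th vertex of part X_{p}
-- (part p has `size p` vertices); (inj₂ i) is w_{a_i b_i}.

Vert : {k : ℕ} → (Fin (suc k) → ℕ) → Set
Vert {k} size = (Σ (Fin (suc k)) λ p → Fin (size p)) ⊎ Fin k

record Setting (k : ℕ) : Set₁ where
  field
    k≥1 : 1 ≤ k
    size : Fin (suc k) → ℕ
    Adj : Vert size → Vert size → Set
    Adj-sym : ∀ u v → Adj u v → Adj v u
    Adj-irrefl : ∀ u → ¬ Adj u u
    clique : ∀ p u u' → u ≢ u' → Adj (inj₁ (p , u)) (inj₁ (p , u'))
    W-indep : ∀ i j → ¬ Adj (inj₂ i) (inj₂ j)
    a b : Fin k → Fin (suc k)
    a≢b : ∀ i → a i ≢ b i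
    w-adj : ∀ i p u → (p ≡ a i ⊎ p ≡ b i) → Adj (inj₂ i) (inj₁ (p , u))
    w-nonadj : ∀ i p u → p ≢ a i → p ≢ b i → ¬ Adj (inj₂ i) (inj₁ (p , u))
    x : (i : Fin k) → Fin (size (inject₁ i))
    r : Fin k → Fin (suc k)
    r≢ : ∀ i → r i ≢ inject₁ i

  root : Fin (suc k)
  root = fromℕ k

  xv : Fin k → Vert size
  xv i = inj₁ (inject₁ i , x i)

  IsX : Vert size → Set
  IsX v = Σ (Fin k) λ i → v ≡ xv i

  WAdj : Fin (suc k) → Fin (suc k) → Set
  WAdj u v = Σ (Fin k) λ i → (a i ≡ u × b i ≡ v) ⊎ (a i ≡ v × b i ≡ u)

  RArc : Fin (suc k) → Fin (suc k) → Set
  RArc u v = Σ (Fin k) λ i → inject₁ i ≡ u × r i ≡ v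

  Incident : Fin k → Fin (suc k) → Set
  Incident i p = a i ≡ p ⊎ b i ≡ p

  field
    x-indep : ∀ i j → ¬ Adj (xv i) (xv j)
    x-adj : ∀ i u → ¬ IsX (inj₁ (r i , u)) → Adj (xv i) (inj₁ (r i , u))
    x-nonadj : ∀ i p u → p ≢ inject₁ i → p ≢ r i → ¬ Adj (xv i) (inj₁ (p , u))
    E-distinct : ∀ i j → i ≢ j →
      ¬ ((a i ≡ a j × b i ≡ b j) ⊎ (a i ≡ b j × b i ≡ a j))
    E-connected : ∀ u v → Σ (List (Fin (suc k))) λ vs → IsPath WAdj u v vs
    E-acyclic : ∀ u v vs → IsPath WAdj u v vs → 3 ≤ length vs → ¬ WAdj v u
    leaf : Σ (Fin k) λ i → Incident i root × (∀ j → Incident j root → j ≡ i)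
    -- A is an in-arborescence rooted at k+1: every vertex has a directed
    -- red path to the root (out-degrees are one except at the root by
    -- construction)
    A-arb : ∀ u → Σ (List (Fin (suc k))) λ vs → IsPath RArc u root vs

record YSet {k : ℕ} (S : Setting k) : Set where
  open Setting S
  field
    y : (p : Fin (suc k)) → Fin (size p)
    y-indep : ∀ p q → ¬ Adj (inj₁ (p , y p)) (inj₁ (q , y q))
    y≢x : ∀ i → inj₁ (inject₁ i , y (inject₁ i)) ≢ xv i

module _ {k : ℕ} (S : Setting k) where
  open Setting S

  private
    Vt = Fin (suc k)

  RedBetween : Vt → Vt → List Vt → Set
  RedBetween s t vs = IsPath RArc s t vs ⊎ IsPath RArc t s vs

  ObstructionTo : Vt → Set
  ObstructionTo v =
    Σ Vt λ a' → Σ Vt λ b' →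
    a' ≢ b' × a' ≢ v × b' ≢ v ×
    Σ (List Vt) λ pw → Σ (List Vt) λ pa → Σ (List Vt) λ pb →
      IsPath WAdj a' b' pw × (len pw ≡ 1 ⊎ len pw ≡ 2)
      × IsPath RArc a' v pa × 1 ≤ len pa
      × IsPath RArc b' v pb × 1 ≤ len pb
      × IntDisj pw a' b' pa a' v
      × IntDisj pw a' b' pb b' v
      × IntDisj pa a' v pb b' v

  AlternatingObstruction : Set
  AlternatingObstruction =
    Σ Vt λ a' → Σ Vt λ b' → Σ Vt λ c → Σ Vt λ d →
    a' ≢ b' × a' ≢ c × a' ≢ d × b' ≢ c × b' ≢ d × c ≢ d ×
    Σ (List Vt) λ p₁ → Σ (List Vt) λ p₂ → Σ (List Vt) λ p₃ → Σ (List Vt) λ p₄ →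
      IsPath WAdj a' b' p₁ × RedBetween b' c p₂
      × IsPath WAdj c d p₃ × RedBetween d a' p₄
      × (len p₁ ≡ 1 ⊎ len p₃ ≡ 1)
      × IntDisj p₁ a' b' p₂ b' c
      × IntDisj p₁ a' b' p₃ c d
      × IntDisj p₁ a' b' p₄ d a'
      × IntDisj p₂ b' c p₃ c d
      × IntDisj p₂ b' c p₄ d a'
      × IntDisj p₃ c d p₄ d a'

module Submission where

-- The vertices x_i, y_p and w_j of G are named by labels whose
-- adjacencies are read off the bi-tree (module Labels).  Along a directed red
-- path the labels x y x y ⋯ y form an induced path with two vertices per arc;
-- read backwards they give y x ⋯ y x; along a white path, w y w ⋯ w gives an
-- induced path with one vertex less than twice the number of edges.  Such
-- pieces (module Pieces) record which of their labels touch the ends of the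
-- underlying path of T, so that pieces along internally disjoint paths glue
-- at common ends, and three of them close up to a hole (module Gluing, on top
-- of the generic module InducedCycle turning a cyclic label sequence into a
-- hole).  An obstruction directed to v, resp. an alternating obstruction,
-- gives three such pieces whose lengths add up to an even number.

open import Defs
open import Data.Nat using (ℕ; suc)
open import Data.Fin using (Fin)
open import Data.Product using (_×_)
open import Relation.Nullary using (¬_)

open import Data.Nat using (zero; _+_; _*_; _≤_; _<_; z≤n; s≤s)
import Data.Nat.Properties as ℕP
open import Algebra.Properties.CommutativeSemigroup ℕP.+-commutativeSemigroup using (interchange)
open import Data.Fin using (toℕ; inject₁; _≟_)
open import Data.Fin.Properties using (inject₁-injective; toℕ-injective)
open import Data.List using (List; []; _∷_; length; head; last; lookup; _++_)
open import Data.List.Properties using (length-++)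
open import Data.List.Relation.Unary.All as All using (All; []; _∷_)
import Data.List.Relation.Unary.All.Properties as AllP
open import Data.List.Relation.Unary.AllPairs using (_∷_)
open import Data.List.Relation.Unary.Any using (here; there)
open import Data.List.Relation.Unary.Linked using (Linked; []; [-]; _∷_)
open import Data.List.Relation.Unary.Unique.Propositional using (Unique)
open import Data.List.Membership.Propositional using (_∈_)
open import Data.List.Membership.Propositional.Properties using (∈-lookup; ∈-++⁺ˡ; ∈-++⁺ʳ; ∈-++⁻)
open import Data.Maybe using (just)
open import Data.Product using (Σ; _,_; proj₁; proj₂)
open import Data.Sum using (_⊎_; inj₁; inj₂; [_,_]; swap)
open import Data.Empty using (⊥; ⊥-elim)
open import Data.Unit using (⊤; tt)
open import Relation.Nullary using (yes; no)
open import Relation.Binary.PropositionalEquality using (_≡_; _≢_; refl; sym; trans; cong; cong₂; subst)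
open import Relation.Binary.Definitions using (tri<; tri≈; tri>)
open import Function.Definitions using (Injective)

head∈ : ∀ {A : Set} (xs : List A) {s} → head xs ≡ just s → s ∈ xs
head∈ (x ∷ xs) refl = here refl

last∈ : ∀ {A : Set} (xs : List A) {z} → last xs ≡ just z → z ∈ xs
last∈ (x ∷ []) refl = here refl
last∈ (x ∷ x' ∷ xs) e = there (last∈ (x' ∷ xs) e)

lastOf : ∀ {A : Set} (q : A) qs → Σ A λ t → last (q ∷ qs) ≡ just t
lastOf q [] = q , refl
lastOf q (q' ∷ qs) = lastOf q' qs

last-++ : ∀ {A : Set} (xs ys : List A) {z} → last ys ≡ just z → last (xs ++ ys) ≡ just z
last-++ [] ys e = e
last-++ (x ∷ []) (y ∷ ys) e = e
last-++ (x ∷ x' ∷ xs) ys e = last-++ (x' ∷ xs) ys e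

head∉tail : ∀ {A : Set} {p : A} {ps} → Unique (p ∷ ps) → ∀ {x} → x ∈ ps → x ≢ p
head∉tail (p∉ ∷ _) x∈ e = All.lookup p∉ x∈ (sym e)

uniqueTail : ∀ {A : Set} {p : A} {ps} → Unique (p ∷ ps) → Unique ps
uniqueTail (_ ∷ u) = u

MeetOnlyAt : {V : Set} → List V → List V → V → Set
MeetOnlyAt P Q c = ∀ u → u ∈ P → u ∈ Q → u ≡ c

meet-sym : ∀ {V : Set} {P Q : List V} {c} → MeetOnlyAt P Q c → MeetOnlyAt Q P c
meet-sym m u u∈Q u∈P = m u u∈P u∈Q

meet-++ : ∀ {V : Set} {P Q Q' : List V} {c} → MeetOnlyAt P Q c → MeetOnlyAt P Q' c → MeetOnlyAt P (Q ++ Q') c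
meet-++ {Q = Q} m m' u u∈P u∈QQ' with ∈-++⁻ Q u∈QQ'
... | inj₁ u∈Q = m u u∈P u∈Q
... | inj₂ u∈Q' = m' u u∈P u∈Q'

meet-intDisj : ∀ {V : Set} {p q : List V} {s t s' t' c} → IntDisj p s t q s' t' →
  (∀ {y} → y ≡ s ⊎ y ≡ t → y ≡ s' ⊎ y ≡ t' → y ≡ c) → MeetOnlyAt p q c
meet-intDisj disj ends y y∈p y∈q = ends (proj₁ (disj y y∈p y∈q)) (proj₂ (disj y y∈p y∈q))

shared-end : ∀ {V : Set} {y u c w : V} → u ≢ w → y ≡ u ⊎ y ≡ c → y ≡ c ⊎ y ≡ w → y ≡ c
shared-end _ (inj₂ e) _ = e
shared-end _ (inj₁ _) (inj₁ e) = e
shared-end u≢w (inj₁ e) (inj₂ e') = ⊥-elim (u≢w (trans (sym e) e'))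

no-shared-end : ∀ {V : Set} {y s t s' t' : V} → s ≢ s' → s ≢ t' → t ≢ s' → t ≢ t' →
  y ≡ s ⊎ y ≡ t → y ≡ s' ⊎ y ≡ t' → ⊥
no-shared-end ne _ _ _ (inj₁ e) (inj₁ e') = ne (trans (sym e) e')
no-shared-end _ ne _ _ (inj₁ e) (inj₂ e') = ne (trans (sym e) e')
no-shared-end _ _ ne _ (inj₂ e) (inj₁ e') = ne (trans (sym e) e')
no-shared-end _ _ _ ne (inj₂ e) (inj₂ e') = ne (trans (sym e) e')

path-ends∈ : ∀ {V : Set} {R : V → V → Set} {s t} ps → IsPath R s t ps → s ∈ ps × t ∈ ps
path-ends∈ ps (_ , _ , hd , lst) = head∈ ps hd , last∈ ps lst

-- Parity.  When paths are glued, their lengths add up and so do the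
-- defects correcting them to even numbers.

even-+ : ∀ {m n} → Even m → Even n → Even (m + n)
even-+ (h , refl) (h' , refl) = h + h' , sym (ℕP.*-distribˡ-+ 2 h h')

even-interchange : ∀ m d n e → Even (m + d) → Even (n + e) → Even ((m + n) + (d + e))
even-interchange m d n e p q = subst Even (interchange m d n e) (even-+ p q)

even-drop2 : ∀ m → Even (m + 2) → Even m
even-drop2 m (zero , e) = ⊥-elim (ℕP.m+1+n≢0 m e)
even-drop2 m (suc h , e) =
  h , ℕP.+-cancelʳ-≡ 2 m (2 * h) (trans e (trans (ℕP.*-suc 2 h) (ℕP.+-comm 2 (2 * h))))

CycAdj-sym : ∀ {m} i j → CycAdj m i j → CycAdj m j i
CycAdj-sym i j (inj₁ e) = inj₂ (inj₁ e)
CycAdj-sym i j (inj₂ (inj₁ e)) = inj₁ e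
CycAdj-sym i j (inj₂ (inj₂ (inj₁ e))) = inj₂ (inj₂ (inj₂ e))
CycAdj-sym i j (inj₂ (inj₂ (inj₂ e))) = inj₂ (inj₂ (inj₁ e))

-- A cyclic sequence of labels in which consecutive labels are
-- Near and all other pairs Far is then a hole; we build such sequences by
-- concatenating induced paths.

module InducedCycle {Lab V : Set} (Adj : V → V → Set) (⟦_⟧ : Lab → V)
  (Near Far : Lab → Lab → Set)
  (Adj-sym : ∀ u v → Adj u v → Adj v u)
  (Adj-irr : ∀ u → ¬ Adj u u)
  (near⇒adj : ∀ {l m} → Near l m → Adj ⟦ l ⟧ ⟦ m ⟧)
  (far⇒nonadj : ∀ {l m} → Far l m → ¬ Adj ⟦ l ⟧ ⟦ m ⟧)
  (far⇒≢ : ∀ {l m} → Far l m → ⟦ l ⟧ ≢ ⟦ m ⟧) where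

  near⇒≢ : ∀ {l m} → Near l m → ⟦ l ⟧ ≢ ⟦ m ⟧
  near⇒≢ {l} n e = Adj-irr ⟦ l ⟧ (subst (Adj ⟦ l ⟧) (sym e) (near⇒adj n))

  near⇒label≢ : ∀ {l m} → Near l m → l ≢ m
  near⇒label≢ n refl = near⇒≢ n refl

  far⇒label≢ : ∀ {l m} → Far l m → l ≢ m
  far⇒label≢ f refl = far⇒≢ f refl

  Induced : List Lab → Set
  Induced [] = ⊤
  Induced (l ∷ []) = ⊤
  Induced (l ∷ m ∷ ls) = Near l m × All (Far l) ls × Induced (m ∷ ls)

  induced-tail : ∀ l ls → Induced (l ∷ ls) → Induced ls
  induced-tail l [] _ = tt
  induced-tail l (m ∷ ms) (_ , _ , ind) = ind

  induced-head∉ : ∀ l ls → Induced (l ∷ ls) → ∀ {m} → m ∈ ls → l ≢ m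
  induced-head∉ l (m ∷ ms) (n , _ , _) (here refl) = near⇒label≢ n
  induced-head∉ l (m ∷ ms) (_ , fs , _) (there m∈) = far⇒label≢ (All.lookup fs m∈)

  induced-classify : ∀ B → Induced B → (i j : Fin (length B)) → toℕ i < toℕ j →
    (toℕ j ≡ suc (toℕ i) × Near (lookup B i) (lookup B j)) ⊎ Far (lookup B i) (lookup B j)
  induced-classify (l ∷ m ∷ ls) (n , _ , _) Fin.zero (Fin.suc Fin.zero) _ = inj₁ (refl , n)
  induced-classify (l ∷ m ∷ ls) (_ , fs , _) Fin.zero (Fin.suc (Fin.suc j)) _ = inj₂ (All.lookup fs (∈-lookup j))
  induced-classify (l ∷ m ∷ ls) (_ , _ , ind) (Fin.suc i) (Fin.suc j) (s≤s i<j)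
    with induced-classify (m ∷ ls) ind i j i<j
  ... | inj₁ (e , n) = inj₁ (cong suc e , n)
  ... | inj₂ f = inj₂ f

  induced-consecutive : ∀ B → Induced B → (i j : Fin (length B)) → toℕ j ≡ suc (toℕ i) →
    Near (lookup B i) (lookup B j)
  induced-consecutive (l ∷ m ∷ ls) (n , _ , _) Fin.zero (Fin.suc Fin.zero) _ = n
  induced-consecutive (l ∷ m ∷ ls) (_ , _ , ind) (Fin.suc i) (Fin.suc j) e =
    induced-consecutive (m ∷ ls) ind i j (ℕP.suc-injective e)

  FarUntilLast : Lab → List Lab → Set
  FarUntilLast l [] = ⊥
  FarUntilLast l (m ∷ []) = Near l m
  FarUntilLast l (m ∷ m' ∷ ms) = Far l m × FarUntilLast l (m' ∷ ms)

  farUntilLast-classify : ∀ l ls → FarUntilLast l ls → (j : Fin (length ls)) →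
    (suc (toℕ j) ≡ length ls × Near l (lookup ls j)) ⊎ Far l (lookup ls j)
  farUntilLast-classify l (m ∷ []) n Fin.zero = inj₁ (refl , n)
  farUntilLast-classify l (m ∷ m' ∷ ms) (f , _) Fin.zero = inj₂ f
  farUntilLast-classify l (m ∷ m' ∷ ms) (_ , fl) (Fin.suc j)
    with farUntilLast-classify l (m' ∷ ms) fl j
  ... | inj₁ (e , n) = inj₁ (cong suc e , n)
  ... | inj₂ f = inj₂ f

  farUntilLast-last : ∀ l ls → FarUntilLast l ls → (j : Fin (length ls)) → suc (toℕ j) ≡ length ls →
    Near l (lookup ls j)
  farUntilLast-last l (m ∷ []) n Fin.zero _ = n
  farUntilLast-last l (m ∷ m' ∷ ms) (_ , fl) (Fin.suc j) e =
    farUntilLast-last l (m' ∷ ms) fl j (ℕP.suc-injective e)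

  farUntilLast-++ : ∀ l xs ys → All (Far l) xs → FarUntilLast l ys → FarUntilLast l (xs ++ ys)
  farUntilLast-++ l [] ys _ fl = fl
  farUntilLast-++ l (x ∷ []) (y ∷ ys) (f ∷ []) fl = f , fl
  farUntilLast-++ l (x ∷ x' ∷ xs) ys (f ∷ fs) fl = f , farUntilLast-++ l (x' ∷ xs) ys fs fl

  farUntilLast-intro : ∀ l ms z → Induced ms → last ms ≡ just z →
    (∀ m → m ∈ ms → m ≢ z → Far l m) → Near l z → FarUntilLast l ms
  farUntilLast-intro l (m ∷ []) z _ refl _ n = n
  farUntilLast-intro l (m ∷ m' ∷ ms) z ind e far n =
    far m (here refl) (induced-head∉ m (m' ∷ ms) ind (last∈ (m' ∷ ms) e)) ,
    farUntilLast-intro l (m' ∷ ms) z (induced-tail m (m' ∷ ms) ind) e (λ m'' m∈ → far m'' (there m∈)) n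

  Closes : Lab → List Lab → Set
  Closes l [] = ⊥
  Closes l (m ∷ ms) = Near l m × FarUntilLast l ms

  closes-classify : ∀ l B → Closes l B → (j : Fin (length B)) →
    ((toℕ j ≡ 0 ⊎ suc (toℕ j) ≡ length B) × Near l (lookup B j)) ⊎ Far l (lookup B j)
  closes-classify l (m ∷ ms) (n , _) Fin.zero = inj₁ (inj₁ refl , n)
  closes-classify l (m ∷ ms) (_ , fl) (Fin.suc j) with farUntilLast-classify l ms fl j
  ... | inj₁ (e , n) = inj₁ (inj₂ (cong suc e) , n)
  ... | inj₂ f = inj₂ f

  closes-first : ∀ l B → Closes l B → (j : Fin (length B)) → toℕ j ≡ 0 → Near l (lookup B j)
  closes-first l (m ∷ ms) (n , _) Fin.zero _ = n

  closes-last : ∀ l B → Closes l B → (j : Fin (length B)) → suc (toℕ j) ≡ length B → Near l (lookup B j)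
  closes-last l (m ∷ []) (_ , ()) Fin.zero _
  closes-last l (m ∷ m' ∷ ms) (_ , fl) (Fin.suc j) e = farUntilLast-last l (m' ∷ ms) fl j (ℕP.suc-injective e)

  Precedes : Lab → List Lab → Set
  Precedes l [] = ⊤
  Precedes l (m ∷ ms) = Near l m × All (Far l) ms

  Glues : List Lab → List Lab → Set
  Glues [] ms = ⊤
  Glues (l ∷ []) ms = Precedes l ms
  Glues (l ∷ l' ∷ ls) ms = All (Far l) ms × Glues (l' ∷ ls) ms

  induced-++ : ∀ ls ms → Induced ls → Induced ms → Glues ls ms → Induced (ls ++ ms)
  induced-++ [] ms _ ind _ = ind
  induced-++ (l ∷ []) [] _ _ _ = tt
  induced-++ (l ∷ []) (m ∷ ms) _ ind (n , fs) = n , fs , ind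
  induced-++ (l ∷ l' ∷ ls) ms (n , fs , ind) ind' (fs' , gl) =
    n , AllP.++⁺ fs fs' , induced-++ (l' ∷ ls) ms ind ind' gl

  glues-intro : ∀ ls ms z → Induced ls → last ls ≡ just z →
    (∀ l → l ∈ ls → l ≢ z → All (Far l) ms) → Precedes z ms → Glues ls ms
  glues-intro (l ∷ []) ms z _ refl _ p = p
  glues-intro (l ∷ l' ∷ ls) ms z ind e far p =
    far l (here refl) (induced-head∉ l (l' ∷ ls) ind (last∈ (l' ∷ ls) e)) ,
    glues-intro (l' ∷ ls) ms z (induced-tail l (l' ∷ ls) ind) e (λ l'' l∈ → far l'' (there l∈)) p

  module ClosedCycle (l : Lab) (B : List Lab) (ind : Induced B) (cl : Closes l B) (3≤ : 3 ≤ length B) where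

    cyc : Fin (suc (length B)) → V
    cyc i = ⟦ lookup (l ∷ B) i ⟧

    CycleLink : (i j : Fin (suc (length B))) → Set
    CycleLink i j = (CycAdj (suc (length B)) i j × Adj (cyc i) (cyc j))
                  ⊎ (¬ Adj (cyc i) (cyc j) × cyc i ≢ cyc j)

    -- the relation is symmetric, so it suffices to compute it for i < j
    linked-sym : ∀ i j → CycleLink i j → CycleLink j i
    linked-sym i j (inj₁ (c , a)) = inj₁ (CycAdj-sym i j c , Adj-sym _ _ a)
    linked-sym i j (inj₂ (na , ne)) = inj₂ ((λ a → na (Adj-sym _ _ a)) , (λ e → ne (sym e)))

    linked< : ∀ i j → toℕ i < toℕ j → CycleLink i j
    linked< Fin.zero (Fin.suc j) _ with closes-classify l B cl j
    ... | inj₁ (inj₁ e , n) = inj₁ (inj₁ (cong suc e) , near⇒adj n)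
    ... | inj₁ (inj₂ e , n) = inj₁ (inj₂ (inj₂ (inj₁ (refl , cong suc e))) , near⇒adj n)
    ... | inj₂ f = inj₂ (far⇒nonadj f , far⇒≢ f)
    linked< (Fin.suc i) (Fin.suc j) (s≤s i<j) with induced-classify B ind i j i<j
    ... | inj₁ (e , n) = inj₁ (inj₁ (cong suc e) , near⇒adj n)
    ... | inj₂ f = inj₂ (far⇒nonadj f , far⇒≢ f)

    linked : ∀ i j → i ≢ j → CycleLink i j
    linked i j i≢j with ℕP.<-cmp (toℕ i) (toℕ j)
    ... | tri< i<j _ _ = linked< i j i<j
    ... | tri≈ _ e _ = ⊥-elim (i≢j (toℕ-injective e))
    ... | tri> _ _ j<i = linked-sym j i (linked< j i j<i)

    injective : Injective _≡_ _≡_ cyc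
    injective {i} {j} e with i ≟ j
    ... | yes i≡j = i≡j
    ... | no i≢j with linked i j i≢j
    ...   | inj₁ (_ , a) = ⊥-elim (Adj-irr _ (subst (Adj (cyc i)) (sym e) a))
    ...   | inj₂ (_ , ne) = ⊥-elim (ne e)

    adj⇒cycAdj : ∀ i j → Adj (cyc i) (cyc j) → CycAdj (suc (length B)) i j
    adj⇒cycAdj i j a with i ≟ j
    ... | yes refl = ⊥-elim (Adj-irr _ a)
    ... | no i≢j with linked i j i≢j
    ...   | inj₁ (c , _) = c
    ...   | inj₂ (na , _) = ⊥-elim (na a)

    follows-near : ∀ i j → toℕ j ≡ suc (toℕ i) ⊎ (toℕ i ≡ 0 × suc (toℕ j) ≡ suc (length B)) →
      Near (lookup (l ∷ B) i) (lookup (l ∷ B) j)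
    follows-near Fin.zero (Fin.suc j) (inj₁ e) = closes-first l B cl j (ℕP.suc-injective e)
    follows-near (Fin.suc i) (Fin.suc j) (inj₁ e) = induced-consecutive B ind i j (ℕP.suc-injective e)
    follows-near Fin.zero Fin.zero (inj₂ (_ , e)) =
      ⊥-elim (ℕP.<⇒≢ (ℕP.≤-trans (s≤s z≤n) 3≤) (ℕP.suc-injective e))
    follows-near Fin.zero (Fin.suc j) (inj₂ (_ , e)) = closes-last l B cl j (ℕP.suc-injective e)

    consecutive-near : ∀ i j → CycAdj (suc (length B)) i j →
      Near (lookup (l ∷ B) i) (lookup (l ∷ B) j) ⊎ Near (lookup (l ∷ B) j) (lookup (l ∷ B) i)
    consecutive-near i j (inj₁ e) = inj₁ (follows-near i j (inj₁ e))
    consecutive-near i j (inj₂ (inj₁ e)) = inj₂ (follows-near j i (inj₁ e))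
    consecutive-near i j (inj₂ (inj₂ (inj₁ e))) = inj₁ (follows-near i j (inj₂ e))
    consecutive-near i j (inj₂ (inj₂ (inj₂ e))) = inj₂ (follows-near j i (inj₂ e))

    cycAdj⇒adj : ∀ i j → CycAdj (suc (length B)) i j → Adj (cyc i) (cyc j)
    cycAdj⇒adj i j c with consecutive-near i j c
    ... | inj₁ n = near⇒adj n
    ... | inj₂ n = Adj-sym _ _ (near⇒adj n)

    isHole : IsHole Adj (suc (length B)) cyc
    isHole = s≤s 3≤ , injective , adj⇒cycAdj , cycAdj⇒adj

module Labels {k : ℕ} (S : Setting k) (Ys : YSet S) where
  open Setting S
  open YSet Ys

  T : Set
  T = Fin (suc k)

  ι : Fin k → T
  ι = inject₁

  data Lab : Set where
    X : Fin k → Lab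
    Y : T → Lab
    W : Fin k → Lab

  ⟦_⟧ : Lab → Vert size
  ⟦ X i ⟧ = xv i
  ⟦ Y p ⟧ = inj₁ (p , y p)
  ⟦ W j ⟧ = inj₂ j

  Near : Lab → Lab → Set
  Near (X i) (Y p) = p ≡ r i ⊎ p ≡ ι i
  Near (Y p) (X i) = p ≡ r i ⊎ p ≡ ι i
  Near (W j) (X i) = ι i ≡ a j ⊎ ι i ≡ b j
  Near (X i) (W j) = ι i ≡ a j ⊎ ι i ≡ b j
  Near (W j) (Y p) = p ≡ a j ⊎ p ≡ b j
  Near (Y p) (W j) = p ≡ a j ⊎ p ≡ b j
  Near _ _ = ⊥

  Far : Lab → Lab → Set
  Far (X i) (X i') = i ≢ i'
  Far (Y p) (Y q) = p ≢ q
  Far (W j) (W j') = j ≢ j'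
  Far (X i) (Y p) = p ≢ r i × p ≢ ι i
  Far (Y p) (X i) = p ≢ r i × p ≢ ι i
  Far (X i) (W j) = ι i ≢ a j × ι i ≢ b j
  Far (W j) (X i) = ι i ≢ a j × ι i ≢ b j
  Far (W j) (Y p) = p ≢ a j × p ≢ b j
  Far (Y p) (W j) = p ≢ a j × p ≢ b j

  Near-sym : ∀ l m → Near l m → Near m l
  Near-sym (X i) (Y p) n = n
  Near-sym (Y p) (X i) n = n
  Near-sym (W j) (X i) n = n
  Near-sym (X i) (W j) n = n
  Near-sym (W j) (Y p) n = n
  Near-sym (Y p) (W j) n = n

  Far-sym : ∀ l m → Far l m → Far m l
  Far-sym (X i) (X i') f e = f (sym e)
  Far-sym (Y p) (Y q) f e = f (sym e)
  Far-sym (W j) (W j') f e = f (sym e)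
  Far-sym (X i) (Y p) f = f
  Far-sym (Y p) (X i) f = f
  Far-sym (X i) (W j) f = f
  Far-sym (W j) (X i) f = f
  Far-sym (Y p) (W j) f = f
  Far-sym (W j) (Y p) f = f

  -- the part of a vertex of some part (W vertices are sent anywhere)
  part : Vert size → T
  part (inj₁ (q , _)) = q
  part (inj₂ _) = root

  y-notX : ∀ p → ¬ IsX (inj₁ (p , y p))
  y-notX p (j , e) with cong part e
  ... | refl = y≢x j e

  x≢y : ∀ i → x i ≢ y (ι i)
  x≢y i e = y≢x i (cong (λ u → inj₁ (ι i , u)) (sym e))

  xy-adj : ∀ i p → p ≡ r i ⊎ p ≡ ι i → Adj (xv i) (inj₁ (p , y p))
  xy-adj i p (inj₁ refl) = x-adj i (y (r i)) (y-notX (r i))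
  xy-adj i p (inj₂ refl) = clique (ι i) (x i) (y (ι i)) (x≢y i)

  near⇒adj : ∀ {l m} → Near l m → Adj ⟦ l ⟧ ⟦ m ⟧
  near⇒adj {X i} {Y p} n = xy-adj i p n
  near⇒adj {Y p} {X i} n = Adj-sym _ _ (xy-adj i p n)
  near⇒adj {W j} {X i} n = w-adj j (ι i) (x i) n
  near⇒adj {X i} {W j} n = Adj-sym _ _ (w-adj j (ι i) (x i) n)
  near⇒adj {W j} {Y p} n = w-adj j p (y p) n
  near⇒adj {Y p} {W j} n = Adj-sym _ _ (w-adj j p (y p) n)

  far⇒nonadj : ∀ {l m} → Far l m → ¬ Adj ⟦ l ⟧ ⟦ m ⟧
  far⇒nonadj {X i} {X i'} _ = x-indep i i'
  far⇒nonadj {Y p} {Y q} _ = y-indep p q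
  far⇒nonadj {W j} {W j'} _ = W-indep j j'
  far⇒nonadj {X i} {Y p} (f₁ , f₂) = x-nonadj i p (y p) f₂ f₁
  far⇒nonadj {Y p} {X i} (f₁ , f₂) adj = x-nonadj i p (y p) f₂ f₁ (Adj-sym _ _ adj)
  far⇒nonadj {X i} {W j} (f₁ , f₂) adj = w-nonadj j (ι i) (x i) f₁ f₂ (Adj-sym _ _ adj)
  far⇒nonadj {W j} {X i} (f₁ , f₂) = w-nonadj j (ι i) (x i) f₁ f₂
  far⇒nonadj {W j} {Y p} (f₁ , f₂) = w-nonadj j p (y p) f₁ f₂
  far⇒nonadj {Y p} {W j} (f₁ , f₂) adj = w-nonadj j p (y p) f₁ f₂ (Adj-sym _ _ adj)

  far⇒≢ : ∀ {l m} → Far l m → ⟦ l ⟧ ≢ ⟦ m ⟧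
  far⇒≢ {X i} {X i'} f e = f (inject₁-injective (cong part e))
  far⇒≢ {Y p} {Y q} f e = f (cong part e)
  far⇒≢ {W j} {W j'} f refl = f refl
  far⇒≢ {X i} {Y p} (_ , f₂) e = f₂ (sym (cong part e))
  far⇒≢ {Y p} {X i} (_ , f₂) e = f₂ (cong part e)

  open InducedCycle Adj ⟦_⟧ Near Far Adj-sym Adj-irrefl near⇒adj far⇒nonadj far⇒≢ public

-- A piece from s to t is an induced path of labels built along a
-- path of T from s to t, together with the invariants needed to glue it to
-- other pieces at s and t: its labels are attached only to vertices of the
-- path (its support), only its first label lives at s, only its last at t,
-- and no x_i aiming at s or t (other than the allowed endpoints) occurs.
-- The defect is 0 or 1 and makes the length plus the defect even.

module Pieces {k : ℕ} (S : Setting k) (Ys : YSet S) where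
  open Setting S
  open YSet Ys
  open Labels S Ys

  At : T → Lab → Set
  At t (X i) = ι i ≡ t
  At t (Y p) = p ≡ t
  At t (W j) = a j ≡ t ⊎ b j ≡ t

  Reaches : T → Lab → Set
  Reaches t (X i) = r i ≡ t
  Reaches t _ = ⊥

  SupportedIn : List T → Lab → Set
  SupportedIn P (X i) = ι i ∈ P × r i ∈ P
  SupportedIn P (Y p) = p ∈ P
  SupportedIn P (W j) = a j ∈ P × b j ∈ P

  supported-mono : ∀ {P Q} l → (∀ {v} → v ∈ P → v ∈ Q) → SupportedIn P l → SupportedIn Q l
  supported-mono (X i) P⊆Q (i∈ , r∈) = P⊆Q i∈ , P⊆Q r∈
  supported-mono (Y p) P⊆Q p∈ = P⊆Q p∈
  supported-mono (W j) P⊆Q (a∈ , b∈) = P⊆Q a∈ , P⊆Q b∈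

  at∈ : ∀ P l {t} → SupportedIn P l → At t l → t ∈ P
  at∈ P (X i) (i∈ , _) refl = i∈
  at∈ P (Y p) p∈ refl = p∈
  at∈ P (W j) (a∈ , _) (inj₁ refl) = a∈
  at∈ P (W j) (_ , b∈) (inj₂ refl) = b∈

  reaches∈ : ∀ P l {t} → SupportedIn P l → Reaches t l → t ∈ P
  reaches∈ P (X i) (_ , r∈) refl = r∈

  Apart : T → Lab → Lab → Set
  Apart t l m = ¬ (At t l × At t m) × ¬ (Reaches t l × m ≡ Y t) × ¬ (l ≡ Y t × Reaches t m)

  apart⇒far : ∀ P Q l m → SupportedIn P l → SupportedIn Q m →
    (∀ t → t ∈ P → t ∈ Q → Apart t l m) → Far l m
  apart⇒far P Q (X i) (X i') (i∈ , _) (i'∈ , _) ap refl = proj₁ (ap (ι i) i∈ i'∈) (refl , refl)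
  apart⇒far P Q (Y p) (Y q) p∈ q∈ ap refl = proj₁ (ap p p∈ q∈) (refl , refl)
  apart⇒far P Q (W j) (W j') (a∈ , _) (a'∈ , _) ap refl = proj₁ (ap (a j) a∈ a'∈) (inj₁ refl , inj₁ refl)
  apart⇒far P Q (X i) (Y p) (i∈ , r∈) p∈ ap =
    (λ { refl → proj₁ (proj₂ (ap p r∈ p∈)) (refl , refl) }) , (λ { refl → proj₁ (ap p i∈ p∈) (refl , refl) })
  apart⇒far P Q (Y p) (X i) p∈ (i∈ , r∈) ap =
    (λ { refl → proj₂ (proj₂ (ap p p∈ r∈)) (refl , refl) }) , (λ { refl → proj₁ (ap p p∈ i∈) (refl , refl) })
  apart⇒far P Q (X i) (W j) (i∈ , _) (a∈ , b∈) ap =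
    (λ { e → proj₁ (ap (ι i) i∈ (subst (_∈ Q) (sym e) a∈)) (refl , inj₁ (sym e)) }) ,
    (λ { e → proj₁ (ap (ι i) i∈ (subst (_∈ Q) (sym e) b∈)) (refl , inj₂ (sym e)) })
  apart⇒far P Q (W j) (X i) (a∈ , b∈) (i∈ , _) ap =
    (λ { e → proj₁ (ap (ι i) (subst (_∈ P) (sym e) a∈) i∈) (inj₁ (sym e) , refl) }) ,
    (λ { e → proj₁ (ap (ι i) (subst (_∈ P) (sym e) b∈) i∈) (inj₂ (sym e) , refl) })
  apart⇒far P Q (Y p) (W j) p∈ (a∈ , b∈) ap =
    (λ { refl → proj₁ (ap p p∈ a∈) (refl , inj₁ refl) }) , (λ { refl → proj₁ (ap p p∈ b∈) (refl , inj₂ refl) })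
  apart⇒far P Q (W j) (Y p) (a∈ , b∈) p∈ ap =
    (λ { refl → proj₁ (ap p a∈ p∈) (inj₁ refl , refl) }) , (λ { refl → proj₁ (ap p b∈ p∈) (inj₂ refl , refl) })

  same-not-near : ∀ {l m n} → l ≡ n → m ≡ n → ¬ Near l m
  same-not-near {n = n} refl refl nr = near⇒label≢ nr refl

  data Kind : Set where
    white red : Kind

  kind : Lab → Kind
  kind (W _) = white
  kind _ = red

  white-red-near : ∀ {t} l m → At t l → At t m → kind l ≡ white → kind m ≡ red → Near l m
  white-red-near (W j) (X i) (inj₁ e) e' _ _ = inj₁ (trans e' (sym e))
  white-red-near (W j) (X i) (inj₂ e) e' _ _ = inj₂ (trans e' (sym e))
  white-red-near (W j) (Y p) (inj₁ e) e' _ _ = inj₁ (trans e' (sym e))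
  white-red-near (W j) (Y p) (inj₂ e) e' _ _ = inj₂ (trans e' (sym e))

  red-white-near : ∀ {t} l m → At t l → At t m → kind l ≡ red → kind m ≡ white → Near l m
  red-white-near l m at at' kl km = Near-sym m l (white-red-near m l at' at km kl)

  record Piece (s t : T) (ks kt : Kind) : Set where
    field
      support : List T
      body : List Lab
      start end : Lab
      rest : List Lab
      body≡ : body ≡ start ∷ rest
      last≡ : last body ≡ just end
      induced : Induced body
      supported : All (SupportedIn support) body
      onlyStartAt : All (λ l → l ≢ start → ¬ At s l) body
      onlyEndAt : All (λ l → l ≢ end → ¬ At t l) body
      reachStart : All (λ l → Reaches s l → l ≡ start ⊎ start ≡ Y s) body
      reachEnd : All (λ l → Reaches t l → end ≡ Y t) body
      endAt : At t end
      startKind : kind start ≡ ks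
      endKind : kind end ≡ kt
      defect : ℕ
      even : Even (length body + defect)

  open Piece public

  module _ {s t : T} {ks kt : Kind} (A : Piece s t ks kt) where

    start∈ : start A ∈ body A
    start∈ = subst (start A ∈_) (sym (body≡ A)) (here refl)

    rest⊆body : ∀ {m} → m ∈ rest A → m ∈ body A
    rest⊆body m∈ = subst (_ ∈_) (sym (body≡ A)) (there m∈)

    start∉rest : ∀ {m} → m ∈ rest A → start A ≢ m
    start∉rest = induced-head∉ (start A) (rest A) (subst Induced (body≡ A) (induced A))

    rest-induced : Induced (rest A)
    rest-induced = induced-tail (start A) (rest A) (subst Induced (body≡ A) (induced A))

    end∈ : end A ∈ body A
    end∈ = last∈ (body A) (last≡ A)

    nonempty : 1 ≤ length (body A)
    nonempty = subst (λ L → 1 ≤ length L) (sym (body≡ A)) (s≤s z≤n)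

    rest-cons : 2 ≤ length (body A) → Σ Lab λ m → Σ (List Lab) λ ms → rest A ≡ m ∷ ms
    rest-cons two with rest A | body≡ A
    ... | m ∷ ms | _ = m , ms , refl
    ... | [] | body≡[start] with subst (λ L → 2 ≤ length L) body≡[start] two
    ...   | s≤s ()

    last-rest : ∀ {m ms} → rest A ≡ m ∷ ms → last (rest A) ≡ just (end A)
    last-rest {m} {ms} rest≡ =
      subst (λ R → last R ≡ just (end A)) (sym rest≡)
        (subst (λ L → last L ≡ just (end A)) (trans (body≡ A) (cong (start A ∷_) rest≡)) (last≡ A))

  junction-far : ∀ {s t u ks kt ks' kt'} (A : Piece s t ks kt) (B : Piece t u ks' kt') →
    MeetOnlyAt (support A) (support B) t → Near (end A) (start B) →
    ∀ {l m} → l ∈ body A → m ∈ body B → l ≢ end A ⊎ m ≢ start B → Far l m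
  junction-far {t = t} A B meet n {l} {m} l∈ m∈ not-junction =
    apart⇒far (support A) (support B) l m (All.lookup (supported A) l∈) (All.lookup (supported B) m∈) apart
    where
    onlyEnd : l ≢ end A → ¬ At t l
    onlyEnd = All.lookup (onlyEndAt A) l∈
    onlyStart : m ≢ start B → ¬ At t m
    onlyStart = All.lookup (onlyStartAt B) m∈
    -- y_t cannot be both the end of A and the start of B: they are Near
    not-both-Y : end A ≡ Y t → start B ≡ Y t → ⊥
    not-both-Y e e' = same-not-near e e' n
    at-Y : ∀ {o} → o ≡ Y t → At t o
    at-Y refl = refl
    at-both : l ≢ end A ⊎ m ≢ start B → ¬ (At t l × At t m)
    at-both (inj₁ l≢) (at , _) = onlyEnd l≢ at
    at-both (inj₂ m≢) (_ , at) = onlyStart m≢ at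
    reach-l : ¬ (Reaches t l × m ≡ Y t)
    reach-l (rc , m≡) =
      onlyStart (λ e → not-both-Y (All.lookup (reachEnd A) l∈ rc) (trans (sym e) m≡)) (at-Y m≡)
    reach-m : l ≢ end A ⊎ m ≢ start B → ¬ (l ≡ Y t × Reaches t m)
    reach-m (inj₁ l≢) (l≡ , _) = onlyEnd l≢ (at-Y l≡)
    reach-m (inj₂ m≢) (l≡ , rc) with All.lookup (reachStart B) m∈ rc
    ... | inj₁ e = m≢ e
    ... | inj₂ e = onlyEnd (λ e' → not-both-Y (trans (sym e') l≡) e) (at-Y l≡)
    apart : ∀ u → u ∈ support A → u ∈ support B → Apart u l m
    apart u u∈A u∈B with meet u u∈A u∈B
    ... | refl = at-both not-junction , reach-l , reach-m not-junction

  redLabels : (ps : List T) → Linked RArc ps → List Lab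
  redLabels [] [] = []
  redLabels (p ∷ []) [-] = []
  redLabels (p ∷ q ∷ ps) ((i , _) ∷ lk) = X i ∷ Y q ∷ redLabels (q ∷ ps) lk

  all-redLabels : ∀ {Q : Lab → Set} p ps lk → Unique (p ∷ ps) → ∀ t → last (p ∷ ps) ≡ just t →
    (∀ i → ι i ∈ (p ∷ ps) → r i ∈ ps → ι i ≢ t → Q (X i)) →
    (∀ q → q ∈ ps → Q (Y q)) → All Q (redLabels (p ∷ ps) lk)
  all-redLabels p [] [-] u t lst onX onY = []
  all-redLabels p (q ∷ ps) ((i , i≡p , ri≡q) ∷ lk) u t lst onX onY =
    onX i (here i≡p) (here ri≡q) (λ e → head∉tail u (last∈ (q ∷ ps) lst) (trans (sym e) i≡p)) ∷
    onY q (here refl) ∷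
    all-redLabels q ps lk (uniqueTail u) t lst
      (λ i' i∈ r∈ → onX i' (there i∈) (there r∈)) (λ q' q∈ → onY q' (there q∈))

  -- The red labels form an induced path: x_{iₘ} sees y_{pₘ₊₁} via its red
  -- arc and y_{pₘ₊₁} sees x_{iₘ₊₁} in the clique X_{pₘ₊₁}; all other pairs are
  -- Far because the path does not repeat vertices.
  mutual
    redLabels-induced : ∀ p ps lk → Unique (p ∷ ps) → Induced (redLabels (p ∷ ps) lk)
    redLabels-induced p [] [-] u = tt
    redLabels-induced p (q ∷ ps) ((i , i≡p , ri≡q) ∷ lk) u =
      inj₁ (sym ri≡q) ,
      all-redLabels q ps lk (uniqueTail u) (proj₁ (lastOf q ps)) (proj₂ (lastOf q ps))
        (λ i' i∈ _ _ e → head∉tail u i∈ (trans (cong ι (sym e)) i≡p))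
        (λ q' q∈ → (λ e → head∉tail (uniqueTail u) q∈ (trans e ri≡q)) ,
                   (λ e → head∉tail u (there q∈) (trans e i≡p))) ,
      Y-redLabels-induced q ps lk (uniqueTail u)

    Y-redLabels-induced : ∀ q ps lk → Unique (q ∷ ps) → Induced (Y q ∷ redLabels (q ∷ ps) lk)
    Y-redLabels-induced q [] [-] u = tt
    Y-redLabels-induced q (q' ∷ ps) lk@((i , i≡q , _) ∷ lk') u =
      inj₂ (sym i≡q) ,
      ((λ e → head∉tail u (here refl) (sym e)) ∷
        all-redLabels q' ps lk' (uniqueTail u) (proj₁ (lastOf q' ps)) (proj₂ (lastOf q' ps))
          (λ _ i∈ r∈ _ → (λ e → head∉tail u (there r∈) (sym e)) , (λ e → head∉tail u i∈ (sym e)))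
          (λ _ q∈ e → head∉tail u (there q∈) (sym e))) ,
      redLabels-induced q (q' ∷ ps) lk u

  last-redLabels : ∀ p q ps lk t → last (q ∷ ps) ≡ just t → last (redLabels (p ∷ q ∷ ps) lk) ≡ just (Y t)
  last-redLabels p q [] (_ ∷ [-]) t refl = refl
  last-redLabels p q (q' ∷ ps) (_ ∷ lk@(_ ∷ _)) t lst = last-redLabels q q' ps lk t lst

  length-redLabels : ∀ p ps lk → length (redLabels (p ∷ ps) lk) ≡ 2 * length ps
  length-redLabels p [] [-] = refl
  length-redLabels p (q ∷ ps) (_ ∷ lk) =
    trans (cong (λ n → suc (suc n)) (length-redLabels q ps lk)) (sym (ℕP.*-suc 2 (length ps)))

  forwardRedPiece : ∀ {s t} ps → IsPath RArc s t ps → s ≢ t →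
    Σ (Piece s t red red) λ A →
      support A ≡ ps × At s (start A) × end A ≡ Y t × defect A ≡ 0 × 2 ≤ length (body A)
  forwardRedPiece [] (_ , _ , () , _) s≢t
  forwardRedPiece (p ∷ []) (_ , _ , refl , refl) s≢t = ⊥-elim (s≢t refl)
  forwardRedPiece {s} {t} (p ∷ q ∷ ps) (lk@((i , i≡p , _) ∷ lk') , u , refl , lst) _ =
    record
      { support = p ∷ q ∷ ps
      ; body = redLabels (p ∷ q ∷ ps) lk
      ; start = X i ; end = Y t ; rest = Y q ∷ redLabels (q ∷ ps) lk' ; body≡ = refl
      ; last≡ = last-redLabels p q ps lk t lst
      ; induced = redLabels-induced p (q ∷ ps) lk u
      ; supported = allRed (λ _ i∈ r∈ _ → i∈ , there r∈) (λ _ q∈ → there q∈)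
      ; onlyStartAt = allRed (λ _ _ _ _ i'≢ at → i'≢ (cong X (inject₁-injective (trans at (sym i≡p)))))
                             (λ _ q∈ _ at → head∉tail u q∈ at)
      ; onlyEndAt = allRed (λ _ _ _ i'≢t _ at → i'≢t at) (λ _ _ q≢ at → q≢ (cong Y at))
      ; reachStart = allRed (λ _ _ r∈ _ rc → ⊥-elim (head∉tail u r∈ rc)) (λ _ _ ())
      ; reachEnd = All.tabulate (λ _ _ → refl)
      ; endAt = refl ; startKind = refl ; endKind = refl
      ; defect = 0
      ; even = length (q ∷ ps) , trans (ℕP.+-identityʳ _) (length-redLabels p (q ∷ ps) lk)
      } , refl , i≡p , refl , refl , s≤s (s≤s z≤n)
    where
    allRed : ∀ {Q : Lab → Set} → (∀ i → ι i ∈ (p ∷ q ∷ ps) → r i ∈ (q ∷ ps) → ι i ≢ t → Q (X i)) →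
      (∀ q' → q' ∈ (q ∷ ps) → Q (Y q')) → All Q (redLabels (p ∷ q ∷ ps) lk)
    allRed = all-redLabels p (q ∷ ps) lk u t lst

  backLabels : (ps : List T) → Linked RArc ps → List Lab
  backLabels [] [] = []
  backLabels (p ∷ []) [-] = []
  backLabels (p ∷ q ∷ []) ((i , _) ∷ [-]) = Y q ∷ X i ∷ []
  backLabels (p ∷ q ∷ q' ∷ ps) ((i , _) ∷ lk) = backLabels (q ∷ q' ∷ ps) lk ++ (Y q ∷ X i ∷ [])

  all-backLabels : ∀ {Q : Lab → Set} p ps lk → Unique (p ∷ ps) → ∀ s → last (p ∷ ps) ≡ just s →
    (∀ i → ι i ∈ (p ∷ ps) → r i ∈ ps → ι i ≢ s → Q (X i)) →
    (∀ q → q ∈ ps → Q (Y q)) → All Q (backLabels (p ∷ ps) lk)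
  all-backLabels p [] [-] u s lst onX onY = []
  all-backLabels p (q ∷ []) ((i , i≡p , ri≡q) ∷ [-]) u s refl onX onY =
    onY q (here refl) ∷ onX i (here i≡p) (here ri≡q) (λ e → head∉tail u (here refl) (trans (sym e) i≡p)) ∷ []
  all-backLabels p (q ∷ q' ∷ ps) ((i , i≡p , ri≡q) ∷ lk) u s lst onX onY =
    AllP.++⁺ (all-backLabels q (q' ∷ ps) lk (uniqueTail u) s lst
               (λ i' i∈ r∈ → onX i' (there i∈) (there r∈)) (λ q'' q∈ → onY q'' (there q∈)))
             (onY q (here refl) ∷
              onX i (here i≡p) (here ri≡q)
                (λ e → head∉tail u (last∈ (q ∷ q' ∷ ps) lst) (trans (sym e) i≡p)) ∷ [])

  last-backLabels : ∀ p q ps i lk → last (backLabels (p ∷ q ∷ ps) (i ∷ lk)) ≡ just (X (proj₁ i))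
  last-backLabels p q [] i [-] = refl
  last-backLabels p q (q' ∷ ps) (i , _) lk = last-++ (backLabels (q ∷ q' ∷ ps) lk) (Y q ∷ X i ∷ []) refl

  -- The backward labels form an induced path: appending y_q x_i to the labels
  -- of the shorter path keeps it induced, the junction x_{i₁} y_q being Near.
  backLabels-induced : ∀ p ps lk → Unique (p ∷ ps) → Induced (backLabels (p ∷ ps) lk)
  backLabels-induced p [] [-] u = tt
  backLabels-induced p (q ∷ []) ((i , _ , ri≡q) ∷ [-]) u = inj₁ (sym ri≡q) , [] , tt
  backLabels-induced p (q ∷ q' ∷ ps) ((i , i≡p , ri≡q) ∷ lk@((i₁ , i₁≡q , _) ∷ _)) u =
    induced-++ (backLabels (q ∷ q' ∷ ps) lk) (Y q ∷ X i ∷ []) (backLabels-induced q (q' ∷ ps) lk (uniqueTail u))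
      (inj₁ (sym ri≡q) , [] , tt)
      (glues-intro _ _ (X i₁) (backLabels-induced q (q' ∷ ps) lk (uniqueTail u)) (last-backLabels q q' ps _ _)
        (λ _ → All.lookup (all-backLabels {Q = λ l → l ≢ X i₁ → All (Far l) (Y q ∷ X i ∷ [])}
                       q (q' ∷ ps) lk (uniqueTail u) s' lst' onX onY))
        (inj₂ (sym i₁≡q) , (λ e → head∉tail u (here refl) (trans (sym (trans (cong ι (sym e)) i₁≡q)) i≡p)) ∷ []))
    where
    s' : T
    s' = proj₁ (lastOf q' ps)
    lst' : last (q' ∷ ps) ≡ just s'
    lst' = proj₂ (lastOf q' ps)
    onX : ∀ i' → ι i' ∈ (q ∷ q' ∷ ps) → r i' ∈ (q' ∷ ps) → ι i' ≢ s' →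
      X i' ≢ X i₁ → All (Far (X i')) (Y q ∷ X i ∷ [])
    onX i' i∈ r∈ _ i'≢ =
      ((λ e → head∉tail (uniqueTail u) r∈ (sym e)) ,
       (λ e → i'≢ (cong X (inject₁-injective (trans (sym e) (sym i₁≡q)))))) ∷
      (λ e → head∉tail u i∈ (trans (cong ι e) i≡p)) ∷ []
    onY : ∀ q'' → q'' ∈ (q' ∷ ps) → Y q'' ≢ X i₁ → All (Far (Y q'')) (Y q ∷ X i ∷ [])
    onY q'' q∈ _ = (λ e → head∉tail (uniqueTail u) q∈ e) ∷
                   ((λ e → head∉tail (uniqueTail u) q∈ (trans e ri≡q)) ,
                    (λ e → head∉tail u (there q∈) (trans e i≡p))) ∷ []

  length-backLabels : ∀ p q ps lk → length (backLabels (p ∷ q ∷ ps) lk) ≡ 2 * length (q ∷ ps)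
  length-backLabels p q [] (_ ∷ [-]) = refl
  length-backLabels p q (q' ∷ ps) (_ ∷ lk) =
    trans (length-++ (backLabels (q ∷ q' ∷ ps) lk))
      (trans (cong (_+ 2) (length-backLabels q q' ps lk))
        (trans (ℕP.+-comm (2 * length (q' ∷ ps)) 2) (sym (ℕP.*-suc 2 (length (q' ∷ ps))))))

  backLabels-shape : ∀ p ps lk → ps ≢ [] → ∀ s → last (p ∷ ps) ≡ just s →
    Σ (Fin k) λ i → Σ (List Lab) λ ms → backLabels (p ∷ ps) lk ≡ Y s ∷ X i ∷ ms × r i ≡ s × ι i ∈ (p ∷ ps)
  backLabels-shape p [] [-] ps≢ s lst = ⊥-elim (ps≢ refl)
  backLabels-shape p (q ∷ []) ((i , i≡p , ri≡q) ∷ [-]) _ s refl = i , [] , refl , ri≡q , here i≡p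
  backLabels-shape p (q ∷ q' ∷ ps) ((i , _) ∷ lk) _ s lst with backLabels-shape q (q' ∷ ps) lk (λ ()) s lst
  ... | i' , ms , eq , ri' , i'∈ =
    i' , ms ++ (Y q ∷ X i ∷ []) , cong (_++ (Y q ∷ X i ∷ [])) eq , ri' , there i'∈

  arc-target∈ : ∀ p ps (lk : Linked RArc (p ∷ ps)) → ∀ {t} → last (p ∷ ps) ≡ just t →
    ∀ i → ι i ∈ (p ∷ ps) → ι i ≢ t → r i ∈ ps
  arc-target∈ p [] [-] refl i (here e) i≢t = ⊥-elim (i≢t e)
  arc-target∈ p (q ∷ ps) ((i₀ , i₀≡p , ri₀≡q) ∷ lk) lst i (here e) _
    rewrite inject₁-injective (trans e (sym i₀≡p)) = here ri₀≡q
  arc-target∈ p (q ∷ ps) (_ ∷ lk) lst i (there i∈) i≢t = there (arc-target∈ q ps lk lst i i∈ i≢t)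

  unique-predecessor : ∀ p ps (lk : Linked RArc (p ∷ ps)) → Unique (p ∷ ps) → ∀ {t} → last (p ∷ ps) ≡ just t →
    ∀ i j → ι i ∈ (p ∷ ps) → ι j ∈ (p ∷ ps) → r i ≡ t → r j ≡ t → i ≡ j
  unique-predecessor p ps lk u {t} lst i j i∈ j∈ ri rj =
    go p ps lk u lst i∈ j∈ (not-last i ri) (not-last j rj)
    where
    not-last : ∀ i → r i ≡ t → ι i ≢ t
    not-last i ri e = r≢ i (trans ri (sym e))
    go : ∀ p ps (lk : Linked RArc (p ∷ ps)) → Unique (p ∷ ps) → last (p ∷ ps) ≡ just t →
      ι i ∈ (p ∷ ps) → ι j ∈ (p ∷ ps) → ι i ≢ t → ι j ≢ t → i ≡ j
    go p [] [-] u refl (here e) _ i≢t _ = ⊥-elim (i≢t e)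
    go p ps lk u lst (here e) (here e') _ _ = inject₁-injective (trans e (sym e'))
    go p (q ∷ ps) ((i₀ , i₀≡p , ri₀≡q) ∷ lk) u lst (here e) (there j∈) _ j≢t
      rewrite inject₁-injective (trans e (sym i₀≡p)) =
      ⊥-elim (head∉tail (uniqueTail u) (arc-target∈ q ps lk lst j j∈ j≢t) (trans rj (trans (sym ri) ri₀≡q)))
    go p (q ∷ ps) ((i₀ , i₀≡p , ri₀≡q) ∷ lk) u lst (there i∈) (here e') i≢t _
      rewrite inject₁-injective (trans e' (sym i₀≡p)) =
      ⊥-elim (head∉tail (uniqueTail u) (arc-target∈ q ps lk lst i i∈ i≢t) (trans ri (trans (sym rj) ri₀≡q)))
    go p (q ∷ ps) (_ ∷ lk) u lst (there i∈) (there j∈) i≢t j≢t =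
      go q ps lk (uniqueTail u) lst i∈ j∈ i≢t j≢t

  EnteredBy : T → List Lab → Set
  EnteredBy s ls = Σ (Fin k) λ i → Σ (List Lab) λ ms →
    ls ≡ X i ∷ ms × r i ≡ s × All (λ l → Reaches s l → l ≡ X i) ls

  backwardRedPiece : ∀ {s t} ps → IsPath RArc t s ps → s ≢ t →
    Σ (Piece s t red red) λ A →
      support A ≡ ps × start A ≡ Y s × defect A ≡ 0 × 2 ≤ length (body A) × EnteredBy s (rest A)
  backwardRedPiece [] (_ , _ , () , _) s≢t
  backwardRedPiece (p ∷ []) (_ , _ , refl , refl) s≢t = ⊥-elim (s≢t refl)
  backwardRedPiece {s} {t} (p ∷ q ∷ ps) (lk@((i , i≡p , _) ∷ _) , u , refl , lst) _
    with backLabels-shape p (q ∷ ps) lk (λ ()) s lst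
  ... | i' , ms , shape , ri' , i'∈ =
    record
      { support = p ∷ q ∷ ps
      ; body = backLabels (p ∷ q ∷ ps) lk
      ; start = Y s ; end = X i ; rest = X i' ∷ ms ; body≡ = shape
      ; last≡ = last-backLabels p q ps _ _
      ; induced = backLabels-induced p (q ∷ ps) lk u
      ; supported = allBack (λ _ i∈ r∈ _ → i∈ , there r∈) (λ _ q∈ → there q∈)
      ; onlyStartAt = allBack (λ _ _ _ i≢s _ at → i≢s at) (λ _ _ q≢ at → q≢ (cong Y at))
      ; onlyEndAt = allBack (λ _ _ _ _ i''≢ at → i''≢ (cong X (inject₁-injective (trans at (sym i≡p)))))
                            (λ _ q∈ _ at → head∉tail u q∈ at)
      ; reachStart = All.tabulate (λ _ _ → inj₂ refl)
      ; reachEnd = allBack (λ _ _ r∈ _ rc → ⊥-elim (head∉tail u r∈ rc)) (λ _ _ ())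
      ; endAt = i≡p ; startKind = refl ; endKind = refl
      ; defect = 0
      ; even = length (q ∷ ps) , trans (ℕP.+-identityʳ _) (length-backLabels p q ps lk)
      } , refl , refl , refl , subst (λ L → 2 ≤ length L) (sym shape) (s≤s (s≤s z≤n)) ,
      (i' , ms , refl , ri' , All.tail (subst (All _) shape sole))
    where
    allBack : ∀ {Q : Lab → Set} → (∀ i → ι i ∈ (p ∷ q ∷ ps) → r i ∈ (q ∷ ps) → ι i ≢ s → Q (X i)) →
      (∀ q' → q' ∈ (q ∷ ps) → Q (Y q')) → All Q (backLabels (p ∷ q ∷ ps) lk)
    allBack = all-backLabels p (q ∷ ps) lk u s lst
    sole : All (λ l → Reaches s l → l ≡ X i') (backLabels (p ∷ q ∷ ps) lk)
    sole = allBack (λ i'' i∈ _ _ ri'' → cong X (unique-predecessor p (q ∷ ps) lk u lst i'' i' i∈ i'∈ ri'' ri'))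
                   (λ _ _ ())

  dropStart : ∀ {s t kt} (A : Piece s t red kt) → EnteredBy s (rest A) →
    Σ (Piece s t red kt) λ D → support D ≡ support A × Reaches s (start D) × defect D ≡ suc (defect A)
  dropStart {s} {t} A (i , ms , rest≡ , ri , sole) =
    record
      { support = support A
      ; body = X i ∷ ms
      ; start = X i ; end = end A ; rest = ms ; body≡ = refl
      ; last≡ = subst (λ L → last L ≡ just (end A)) split (last≡ A)
      ; induced = induced-tail (start A) (X i ∷ ms) (subst Induced split (induced A))
      ; supported = onRest (supported A)
      ; onlyStartAt = All.tabulate λ l∈ _ →
          All.lookup (onlyStartAt A) (rest⊆body A (inRest l∈)) (λ e → start∉rest A (inRest l∈) (sym e))
      ; onlyEndAt = onRest (onlyEndAt A)
      ; reachStart = All.map (λ same rc → inj₁ (same rc)) (subst (All _) rest≡ sole)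
      ; reachEnd = onRest (reachEnd A)
      ; endAt = endAt A ; startKind = refl ; endKind = endKind A
      ; defect = suc (defect A)
      ; even = proj₁ (even A) , trans (ℕP.+-suc (length (X i ∷ ms)) (defect A))
                                  (trans (cong (λ L → length L + defect A) (sym split)) (proj₂ (even A)))
      } , refl , ri , refl
    where
    split : body A ≡ start A ∷ X i ∷ ms
    split = trans (body≡ A) (cong (start A ∷_) rest≡)
    inRest : ∀ {l} → l ∈ X i ∷ ms → l ∈ rest A
    inRest = subst (_ ∈_) (sym rest≡)
    onRest : ∀ {Q : Lab → Set} → All Q (body A) → All Q (X i ∷ ms)
    onRest q = All.tail (subst (All _) split q)

  Ends : Fin k → T → T → Set
  Ends j u v = (a j ≡ u × b j ≡ v) ⊎ (a j ≡ v × b j ≡ u)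

  ends-first : ∀ {j u v} → Ends j u v → a j ≡ u ⊎ b j ≡ u
  ends-first (inj₁ (e , _)) = inj₁ e
  ends-first (inj₂ (_ , e)) = inj₂ e

  a∈ends : ∀ {j u v L} → Ends j u v → a j ∈ (u ∷ v ∷ L)
  a∈ends (inj₁ (e , _)) = here e
  a∈ends (inj₂ (e , _)) = there (here e)

  b∈ends : ∀ {j u v L} → Ends j u v → b j ∈ (u ∷ v ∷ L)
  b∈ends (inj₁ (_ , e)) = there (here e)
  b∈ends (inj₂ (_ , e)) = here e

  off-edge : ∀ {j u v w} → Ends j u v → w ≢ u → w ≢ v → w ≢ a j × w ≢ b j
  off-edge (inj₁ (e , e')) w≢u w≢v = (λ e'' → w≢u (trans e'' e)) , (λ e'' → w≢v (trans e'' e'))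
  off-edge (inj₂ (e , e')) w≢u w≢v = (λ e'' → w≢v (trans e'' e)) , (λ e'' → w≢u (trans e'' e'))

  off-edge⇒¬At : ∀ {j w} → w ≢ a j × w ≢ b j → ¬ At w (W j)
  off-edge⇒¬At (w≢a , _) (inj₁ e) = w≢a (sym e)
  off-edge⇒¬At (_ , w≢b) (inj₂ e) = w≢b (sym e)

  whiteLabels : (us : List T) → Linked WAdj us → List Lab
  whiteLabels [] [] = []
  whiteLabels (u ∷ []) [-] = []
  whiteLabels (u ∷ v ∷ []) ((j , _) ∷ [-]) = W j ∷ []
  whiteLabels (u ∷ v ∷ v' ∷ us) ((j , _) ∷ lk) = W j ∷ Y v ∷ whiteLabels (v ∷ v' ∷ us) lk

  all-whiteLabels : ∀ {Q : Lab → Set} u us lk → Unique (u ∷ us) → ∀ t → last (u ∷ us) ≡ just t →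
    (∀ j → a j ∈ (u ∷ us) → b j ∈ (u ∷ us) → Q (W j)) →
    (∀ q → q ∈ us → q ≢ t → Q (Y q)) → All Q (whiteLabels (u ∷ us) lk)
  all-whiteLabels u [] [-] un t lst onW onY = []
  all-whiteLabels u (v ∷ []) ((j , en) ∷ [-]) un t lst onW onY = onW j (a∈ends en) (b∈ends en) ∷ []
  all-whiteLabels u (v ∷ v' ∷ us) ((j , en) ∷ lk) un t lst onW onY =
    onW j (a∈ends en) (b∈ends en) ∷
    onY v (here refl) (λ e → head∉tail (uniqueTail un) (last∈ (v' ∷ us) lst) (sym e)) ∷
    all-whiteLabels v (v' ∷ us) lk (uniqueTail un) t lst (λ j' a∈ b∈ → onW j' (there a∈) (there b∈))
      (λ q q∈ → onY q (there q∈))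

  avoids-head : ∀ {u L j} → Unique (u ∷ L) → a j ∈ L → b j ∈ L → ¬ At u (W j)
  avoids-head un a∈ _ (inj₁ e) = head∉tail un a∈ e
  avoids-head un _ b∈ (inj₂ e) = head∉tail un b∈ e

  near-second : ∀ {j u v} → Ends j u v → v ≡ a j ⊎ v ≡ b j
  near-second (inj₁ (_ , e)) = inj₂ (sym e)
  near-second (inj₂ (e , _)) = inj₁ (sym e)

  near-first : ∀ {j u v} → Ends j u v → u ≡ a j ⊎ u ≡ b j
  near-first (inj₁ (e , _)) = inj₁ (sym e)
  near-first (inj₂ (_ , e)) = inj₂ (sym e)

  -- The white labels form an induced path: w_j sees the y's at its ends,
  -- all other pairs are Far because the path does not repeat vertices.
  mutual
    whiteLabels-induced : ∀ u us lk → Unique (u ∷ us) → Induced (whiteLabels (u ∷ us) lk)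
    whiteLabels-induced u [] [-] un = tt
    whiteLabels-induced u (v ∷ []) (_ ∷ [-]) un = tt
    whiteLabels-induced u (v ∷ v' ∷ us) ((j , en) ∷ lk) un =
      near-second en ,
      all-whiteLabels v (v' ∷ us) lk (uniqueTail un) (proj₁ (lastOf v' us)) (proj₂ (lastOf v' us))
        (λ j' a∈ b∈ e → avoids-head un (subst (λ w → a w ∈ _) (sym e) a∈) (subst (λ w → b w ∈ _) (sym e) b∈)
                          (ends-first en))
        (λ q q∈ _ → off-edge en (λ e → head∉tail un (there q∈) e) (λ e → head∉tail (uniqueTail un) q∈ e)) ,
      Y-whiteLabels-induced v (v' ∷ us) lk (uniqueTail un)

    Y-whiteLabels-induced : ∀ v us lk → Unique (v ∷ us) → Induced (Y v ∷ whiteLabels (v ∷ us) lk)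
    Y-whiteLabels-induced v [] [-] un = tt
    Y-whiteLabels-induced v (v' ∷ []) ((j , en) ∷ [-]) un = near-first en , [] , tt
    Y-whiteLabels-induced v (v' ∷ v'' ∷ us) ((j , en) ∷ lk) un =
      near-first en ,
      ((λ e → head∉tail un (here refl) (sym e)) ∷
        all-whiteLabels v' (v'' ∷ us) lk (uniqueTail un) (proj₁ (lastOf v'' us)) (proj₂ (lastOf v'' us))
          (λ _ a∈ b∈ → (λ e → head∉tail un a∈ (sym e)) , (λ e → head∉tail un b∈ (sym e)))
          (λ _ q∈ _ e → head∉tail un (there q∈) (sym e))) ,
      whiteLabels-induced v (v' ∷ v'' ∷ us) ((j , en) ∷ lk) un

  lastEdge : ∀ u v us → Linked WAdj (u ∷ v ∷ us) → Fin k
  lastEdge u v [] ((j , _) ∷ [-]) = j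
  lastEdge u v (v' ∷ us) (_ ∷ lk) = lastEdge v v' us lk

  whiteRest : ∀ v us → Linked WAdj (v ∷ us) → List Lab
  whiteRest v [] [-] = []
  whiteRest v (v' ∷ us) lk = Y v ∷ whiteLabels (v ∷ v' ∷ us) lk

  whiteLabels≡ : ∀ u v us j en lk → whiteLabels (u ∷ v ∷ us) ((j , en) ∷ lk) ≡ W j ∷ whiteRest v us lk
  whiteLabels≡ u v [] j en [-] = refl
  whiteLabels≡ u v (v' ∷ us) j en lk = refl

  last-whiteLabels : ∀ u v us lk → last (whiteLabels (u ∷ v ∷ us) lk) ≡ just (W (lastEdge u v us lk))
  last-whiteLabels u v [] ((j , _) ∷ [-]) = refl
  last-whiteLabels u v (v' ∷ []) (_ ∷ lk@(_ ∷ [-])) = last-whiteLabels v v' [] lk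
  last-whiteLabels u v (v' ∷ v'' ∷ us) (_ ∷ lk@(_ ∷ _)) = last-whiteLabels v v' (v'' ∷ us) lk

  lastEdge-at : ∀ u v us lk {t} → last (u ∷ v ∷ us) ≡ just t → At t (W (lastEdge u v us lk))
  lastEdge-at u v [] ((j , inj₁ (_ , e)) ∷ [-]) refl = inj₂ e
  lastEdge-at u v [] ((j , inj₂ (e , _)) ∷ [-]) refl = inj₁ e
  lastEdge-at u v (v' ∷ us) (_ ∷ lk) lst = lastEdge-at v v' us lk lst

  whiteLabels-onlyEndAt : ∀ u v us lk → Unique (u ∷ v ∷ us) → ∀ t → last (u ∷ v ∷ us) ≡ just t →
    All (λ l → l ≢ W (lastEdge u v us lk) → ¬ At t l) (whiteLabels (u ∷ v ∷ us) lk)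
  whiteLabels-onlyEndAt u v [] ((j , _) ∷ [-]) un t lst = (λ j≢ → ⊥-elim (j≢ refl)) ∷ []
  whiteLabels-onlyEndAt u v (v' ∷ us) ((j , en) ∷ lk) un t lst =
    (λ _ → off-edge⇒¬At (off-edge en (λ e → head∉tail un (there t∈) e)
                                     (λ e → head∉tail (uniqueTail un) t∈ e))) ∷
    (λ _ at → head∉tail (uniqueTail un) t∈ (sym at)) ∷
    whiteLabels-onlyEndAt v v' us lk (uniqueTail un) t lst
    where
    t∈ : t ∈ (v' ∷ us)
    t∈ = last∈ (v' ∷ us) lst

  length-whiteLabels : ∀ u v us lk → length (whiteLabels (u ∷ v ∷ us) lk) + 1 ≡ 2 * length (v ∷ us)
  length-whiteLabels u v [] (_ ∷ [-]) = refl
  length-whiteLabels u v (v' ∷ us) (_ ∷ lk) =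
    trans (cong (λ n → suc (suc n)) (length-whiteLabels v v' us lk)) (sym (ℕP.*-suc 2 (length (v' ∷ us))))

  whitePiece : ∀ {s t} us → IsPath WAdj s t us → s ≢ t →
    Σ (Piece s t white white) λ A → support A ≡ us × At s (start A) × defect A ≡ 1
  whitePiece [] (_ , _ , () , _) s≢t
  whitePiece (u ∷ []) (_ , _ , refl , refl) s≢t = ⊥-elim (s≢t refl)
  whitePiece {s} {t} (u ∷ v ∷ us) (lk@((j , en) ∷ lk') , un , refl , lst) _ =
    record
      { support = u ∷ v ∷ us
      ; body = whiteLabels (u ∷ v ∷ us) lk
      ; start = W j ; end = W (lastEdge u v us lk) ; rest = whiteRest v us lk'
      ; body≡ = whiteLabels≡ u v us j en lk'
      ; last≡ = last-whiteLabels u v us lk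
      ; induced = whiteLabels-induced u (v ∷ us) lk un
      ; supported = allWhite (λ _ a∈ b∈ → a∈ , b∈) (λ _ q∈ _ → there q∈)
      ; onlyStartAt = onlyStart us lk' un lst
      ; onlyEndAt = whiteLabels-onlyEndAt u v us lk un t lst
      ; reachStart = allWhite (λ _ _ _ ()) (λ _ _ _ ())
      ; reachEnd = allWhite (λ _ _ _ ()) (λ _ _ _ ())
      ; endAt = lastEdge-at u v us lk lst
      ; startKind = refl ; endKind = refl
      ; defect = 1
      ; even = length (v ∷ us) , length-whiteLabels u v us lk
      } , refl , ends-first en , refl
    where
    allWhite : ∀ {Q : Lab → Set} → (∀ j → a j ∈ (u ∷ v ∷ us) → b j ∈ (u ∷ v ∷ us) → Q (W j)) →
      (∀ q → q ∈ (v ∷ us) → q ≢ t → Q (Y q)) → All Q (whiteLabels (u ∷ v ∷ us) lk)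
    allWhite = all-whiteLabels u (v ∷ us) lk un t lst
    onlyStart : ∀ us lk' → Unique (u ∷ v ∷ us) → last (u ∷ v ∷ us) ≡ just t →
      All (λ l → l ≢ W j → ¬ At u l) (whiteLabels (u ∷ v ∷ us) ((j , en) ∷ lk'))
    onlyStart [] [-] un lst = (λ j≢ → ⊥-elim (j≢ refl)) ∷ []
    onlyStart (v' ∷ us) lk' un lst =
      (λ j≢ → ⊥-elim (j≢ refl)) ∷ (λ _ at → head∉tail un (here refl) at) ∷
      all-whiteLabels v (v' ∷ us) lk' (uniqueTail un) t lst (λ _ a∈ b∈ _ → avoids-head un a∈ b∈)
        (λ _ q∈ _ _ at → head∉tail un (there q∈) at)

module Gluing {k : ℕ} (S : Setting k) (Ys : YSet S) where
  open Setting S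
  open Labels S Ys
  open Pieces S Ys

  Y-near-reaching : ∀ {t} l → Reaches t l → Near (Y t) l
  Y-near-reaching (X i) rc = inj₁ (sym rc)

  precedes-piece : ∀ {s t ks kt} (B : Piece s t ks kt) l L →
    Near l (start B) → All (Far l) (rest B ++ L) → Precedes l (body B ++ L)
  precedes-piece B l L n fs = subst (λ M → Precedes l (M ++ L)) (sym (body≡ B)) (n , fs)

  module Junction {s t u ks kt ks' ku} (A : Piece s t ks kt) (B : Piece t u ks' ku)
    (meet : MeetOnlyAt (support A) (support B) t) (near : Near (end A) (start B)) where

    far-from-B : ∀ l → l ∈ body A → l ≢ end A → All (Far l) (body B)
    far-from-B l l∈ l≢ = All.tabulate λ m∈ → junction-far A B meet near l∈ m∈ (inj₁ l≢)

    end-far-rest : All (Far (end A)) (rest B)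
    end-far-rest = All.tabulate λ m∈ →
      junction-far A B meet near (end∈ A) (rest⊆body B m∈) (inj₂ (λ e → start∉rest B m∈ (sym e)))

    glues : Glues (body A) (body B)
    glues = glues-intro (body A) (body B) (end A) (induced A) (last≡ A) far-from-B
              (subst (Precedes (end A)) (sym (body≡ B)) (near , end-far-rest))

  concatPieces : ∀ {s t u ks kt ks' ku} (A : Piece s t ks kt) (B : Piece t u ks' ku) →
    MeetOnlyAt (support A) (support B) t → Near (end A) (start B) →
    (∀ v → v ∈ support B → v ≢ s) → (∀ v → v ∈ support A → v ≢ u) →
    Σ (Piece s u ks ku) λ C →
      support C ≡ support A ++ support B × start C ≡ start A × end C ≡ end B × defect C ≡ defect A + defect B
  concatPieces {s} {t} {u} A B meet near s∉B u∉A =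
    record
      { support = support A ++ support B
      ; body = body A ++ body B
      ; start = start A ; end = end B ; rest = rest A ++ body B
      ; body≡ = cong (_++ body B) (body≡ A)
      ; last≡ = last-++ (body A) (body B) (last≡ B)
      ; induced = induced-++ (body A) (body B) (induced A) (induced B) (Junction.glues A B meet near)
      ; supported = AllP.++⁺ (All.map (λ {l} → supported-mono l ∈-++⁺ˡ) (supported A))
                             (All.map (λ {l} → supported-mono l (∈-++⁺ʳ (support A))) (supported B))
      ; onlyStartAt = AllP.++⁺ (onlyStartAt A) (All.tabulate λ {l} l∈ _ at → s∉B s (atB l∈ at) refl)
      ; onlyEndAt = AllP.++⁺ (All.tabulate λ {l} l∈ _ at → u∉A u (atA l∈ at) refl) (onlyEndAt B)
      ; reachStart = AllP.++⁺ (reachStart A) (All.tabulate λ {l} l∈ rc → ⊥-elim (s∉B s (reachB l∈ rc) refl))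
      ; reachEnd = AllP.++⁺ (All.tabulate λ {l} l∈ rc → ⊥-elim (u∉A u (reachA l∈ rc) refl)) (reachEnd B)
      ; endAt = endAt B ; startKind = startKind A ; endKind = endKind B
      ; defect = defect A + defect B
      ; even = subst (λ n → Even (n + (defect A + defect B))) (sym (length-++ (body A)))
                 (even-interchange (length (body A)) (defect A) (length (body B)) (defect B) (even A) (even B))
      } , refl , refl , refl , refl
    where
    atA : ∀ {l v} → l ∈ body A → At v l → v ∈ support A
    atA {l} l∈ = at∈ (support A) l (All.lookup (supported A) l∈)
    atB : ∀ {l v} → l ∈ body B → At v l → v ∈ support B
    atB {l} l∈ = at∈ (support B) l (All.lookup (supported B) l∈)
    reachA : ∀ {l v} → l ∈ body A → Reaches v l → v ∈ support A
    reachA {l} l∈ = reaches∈ (support A) l (All.lookup (supported A) l∈)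
    reachB : ∀ {l v} → l ∈ body B → Reaches v l → v ∈ support B
    reachB {l} l∈ = reaches∈ (support B) l (All.lookup (supported B) l∈)

  module Triangle {x₁ x₂ x₃ k₁ k₂ k₃ k₄ k₅ k₆}
    (A : Piece x₁ x₂ k₁ k₂) (B : Piece x₂ x₃ k₃ k₄) (C : Piece x₃ x₁ k₅ k₆) (two : 2 ≤ length (body A))
    (mAB : MeetOnlyAt (support A) (support B) x₂) (mBC : MeetOnlyAt (support B) (support C) x₃)
    (mCA : MeetOnlyAt (support C) (support A) x₁)
    (nAB : Near (end A) (start B)) (nBC : Near (end B) (start C)) (nCA : Near (end C) (start A)) where

    module AB = Junction A B mAB nAB
    module BC = Junction B C mBC nBC

    cycleTail : List Lab
    cycleTail = rest A ++ (body B ++ body C)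

    h₁ : Lab
    h₁ = proj₁ (rest-cons A two)
    t₁ : List Lab
    t₁ = proj₁ (proj₂ (rest-cons A two))
    rest≡ : rest A ≡ h₁ ∷ t₁
    rest≡ = proj₂ (proj₂ (rest-cons A two))

    inducedA : Induced (start A ∷ h₁ ∷ t₁)
    inducedA = subst Induced (trans (body≡ A) (cong (start A ∷_) rest≡)) (induced A)

    end∈rest : end A ∈ rest A
    end∈rest = last∈ (rest A) (last-rest A rest≡)

    far-C-A : ∀ {l m} → l ∈ body A → m ∈ body C → m ≢ end C ⊎ l ≢ start A → Far l m
    far-C-A {l} {m} l∈ m∈ ne = Far-sym m l (junction-far C A mCA nCA m∈ l∈ ne)

    far-rest-C : ∀ {l} → l ∈ rest A → All (Far l) (body C)
    far-rest-C l∈ = All.tabulate λ m∈ → far-C-A (rest⊆body A l∈) m∈ (inj₂ (λ e → start∉rest A l∈ (sym e)))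

    cycleTail-induced : Induced cycleTail
    cycleTail-induced =
      induced-++ (rest A) (body B ++ body C) (rest-induced A)
        (induced-++ (body B) (body C) (induced B) (induced C) BC.glues)
        (glues-intro (rest A) (body B ++ body C) (end A) (rest-induced A) (last-rest A rest≡)
          (λ l l∈ l≢ → AllP.++⁺ (AB.far-from-B l (rest⊆body A l∈) l≢) (far-rest-C l∈))
          (precedes-piece B (end A) (body C) nAB (AllP.++⁺ AB.end-far-rest (far-rest-C end∈rest))))

    start-closes : Closes (start A) cycleTail
    start-closes = subst (λ R → Closes (start A) (R ++ (body B ++ body C))) (sym rest≡)
      (proj₁ inducedA ,
       farUntilLast-++ (start A) t₁ (body B ++ body C) (proj₁ (proj₂ inducedA))
         (farUntilLast-++ (start A) (body B) (body C)
           (AB.far-from-B (start A) (start∈ A) (λ e → start∉rest A end∈rest e))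
           (farUntilLast-intro (start A) (body C) (end C) (induced C) (last≡ C)
             (λ m m∈ m≢ → far-C-A (start∈ A) m∈ (inj₁ m≢)) (Near-sym (end C) (start A) nCA))))

    length-cycleTail : length cycleTail ≡ length (rest A) + (length (body B) + length (body C))
    length-cycleTail = trans (length-++ (rest A)) (cong (length (rest A) +_) (length-++ (body B)))

    three : 3 ≤ length cycleTail
    three = subst (3 ≤_) (sym length-cycleTail)
      (ℕP.+-mono-≤ (subst (λ R → 1 ≤ length R) (sym rest≡) (s≤s z≤n)) (ℕP.+-mono-≤ (nonempty B) (nonempty C)))

    hole : Σ ℕ λ m → Σ (Fin m → Vert size) λ g →
      IsHole Adj m g × m ≡ length (body A) + (length (body B) + length (body C))
    hole = suc (length cycleTail) , ClosedCycle.cyc (start A) cycleTail cycleTail-induced start-closes three ,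
           ClosedCycle.isHole (start A) cycleTail cycleTail-induced start-closes three ,
           trans (cong suc length-cycleTail) (cong (λ L → length L + _) (sym (body≡ A)))

    even-length : defect A + (defect B + defect C) ≡ 2 →
      Even (length (body A) + (length (body B) + length (body C)))
    even-length total = even-drop2 lengths (subst (λ d → Even (lengths + d)) total
      (even-interchange (length (body A)) (defect A) (length (body B) + length (body C)) (defect B + defect C) (even A)
        (even-interchange (length (body B)) (defect B) (length (body C)) (defect C) (even B) (even C))))
      where
      lengths : ℕ
      lengths = length (body A) + (length (body B) + length (body C))

module Obstructions {k : ℕ} (S : Setting k) (Ys : YSet S) (noEvenHole : NoEvenHole (Setting.Adj S)) where
  open Setting S
  open Labels S Ys
  open Pieces S Ys
  open Gluing S Ys

  no-even-triangle : ∀ {x₁ x₂ x₃ k₁ k₂ k₃ k₄ k₅ k₆}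
    (A : Piece x₁ x₂ k₁ k₂) (B : Piece x₂ x₃ k₃ k₄) (C : Piece x₃ x₁ k₅ k₆) → 2 ≤ length (body A) →
    MeetOnlyAt (support A) (support B) x₂ → MeetOnlyAt (support B) (support C) x₃ →
    MeetOnlyAt (support C) (support A) x₁ →
    Near (end A) (start B) → Near (end B) (start C) → Near (end C) (start A) →
    defect A + (defect B + defect C) ≡ 2 → ⊥
  no-even-triangle A B C two mAB mBC mCA nAB nBC nCA total
    with Triangle.hole A B C two mAB mBC mCA nAB nBC nCA
  ... | m , g , isHole , m≡ =
    noEvenHole m g isHole (subst Even (sym m≡) (Triangle.even-length A B C two mAB mBC mCA nAB nBC nCA total))

  redPiece : ∀ {s t} ps → RedBetween S s t ps → s ≢ t →
    Σ (Piece s t red red) λ A → support A ≡ ps × At s (start A) × defect A ≡ 0 × 2 ≤ length (body A)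
  redPiece ps (inj₁ path) s≢t with forwardRedPiece ps path s≢t
  ... | A , supp , at , _ , d , two = A , supp , at , d , two
  redPiece {s} ps (inj₂ path) s≢t with backwardRedPiece ps path s≢t
  ... | A , supp , start≡ , d , two , _ = A , supp , subst (At s) (sym start≡) refl , d , two

  redBetween-ends∈ : ∀ {s t} ps → RedBetween S s t ps → s ∈ ps × t ∈ ps
  redBetween-ends∈ ps (inj₁ path) = path-ends∈ ps path
  redBetween-ends∈ ps (inj₂ path) = proj₂ (path-ends∈ ps path) , proj₁ (path-ends∈ ps path)

  meet-supports : ∀ {P Q p q : List T} {c} → P ≡ p → Q ≡ q → MeetOnlyAt p q c → MeetOnlyAt P Q c
  meet-supports refl refl m = m

  -- An obstruction directed to v closes up the red path from b to v, the red
  -- path from a to v read backwards without y_v, and the white path from a to b.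
  no-obstruction-to : ∀ v → ¬ ObstructionTo S v
  no-obstruction-to v (a' , b' , a'≢b' , a'≢v , b'≢v , pw , pa , pb , pw-path , _ , pa-path , _ , pb-path , _ ,
                       dwa , dwb , dab)
    with forwardRedPiece pb pb-path b'≢v | backwardRedPiece pa pa-path (λ e → a'≢v (sym e))
       | whitePiece pw pw-path a'≢b'
  ... | A , suppA , atA , endA≡ , dA , two | B₀ , suppB₀ , _ , dB₀ , _ , entry | C , suppC , atC , dC
    with dropStart B₀ entry
  ... | B , suppB , reachB , dB =
    no-even-triangle A B C two
      (meet-supports suppA (trans suppB suppB₀)
        (meet-sym (meet-intDisj dab λ ea eb → shared-end a'≢b' ea (swap eb))))
      (meet-supports (trans suppB suppB₀) suppC
        (meet-sym (meet-intDisj dwa λ ew ea → shared-end b'≢v (swap ew) ea)))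
      (meet-supports suppC suppA (meet-intDisj dwb λ ew eb → shared-end a'≢v ew eb))
      (subst (λ l → Near l (start B)) (sym endA≡) (Y-near-reaching (start B) reachB))
      (red-white-near (end B) (start C) (endAt B) atC (endKind B) (startKind C))
      (white-red-near (end C) (start A) (endAt C) atA (endKind C) (startKind A))
      (cong₂ _+_ dA (cong₂ _+_ (trans dB (cong suc dB₀)) dC))

  -- An alternating obstruction closes up the red path between b and c, the
  -- white path from c to d followed by the red path between d and a, and the
  -- white path from a to b.
  no-alternating : ¬ AlternatingObstruction S
  no-alternating (a' , b' , c , d , a'≢b' , a'≢c , a'≢d , b'≢c , b'≢d , c≢d , p₁ , p₂ , p₃ , p₄ ,
                  path₁ , red₂ , path₃ , red₄ , _ , d12 , d13 , d14 , d23 , d24 , d34)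
    with redPiece p₂ red₂ b'≢c | redPiece p₄ red₄ (λ e → a'≢d (sym e)) | whitePiece p₃ path₃ c≢d
       | whitePiece p₁ path₁ a'≢b'
  ... | R₂ , supp₂ , at₂ , dR₂ , two | R₄ , supp₄ , at₄ , dR₄ , _ | W₃ , supp₃ , at₃ , dW₃ | W₁ , supp₁ , at₁ , dW₁ =
    no-even-triangle R₂ M W₁ two
      (meet-supports supp₂ suppM' (meet-++ (meet-intDisj d23 (shared-end b'≢d))
                                           (meet-intDisj d24 λ e e' → ⊥-elim (no-shared-end b'≢d b'≢a' c≢d c≢a' e e'))))
      (meet-supports suppM' supp₁ (meet-sym (meet-++
        (meet-intDisj d13 λ e e' → ⊥-elim (no-shared-end a'≢c a'≢d b'≢c b'≢d e e'))
        (meet-intDisj d14 λ e e' → shared-end b'≢d (swap e) (swap e')))))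
      (meet-supports supp₁ supp₂ (meet-intDisj d12 (shared-end a'≢c)))
      (subst (Near (end R₂)) (sym startM)
        (red-white-near (end R₂) (start W₃) (endAt R₂) at₃ (endKind R₂) (startKind W₃)))
      (subst (λ l → Near l (start W₁)) (sym endM)
        (red-white-near (end R₄) (start W₁) (endAt R₄) at₁ (endKind R₄) (startKind W₁)))
      (white-red-near (end W₁) (start R₂) (endAt W₁) at₂ (endKind W₁) (startKind R₂))
      (cong₂ _+_ dR₂ (cong₂ _+_ (trans dM (cong₂ _+_ dW₃ dR₄)) dW₁))
    where
    b'≢a' : b' ≢ a'
    b'≢a' e = a'≢b' (sym e)
    c≢a' : c ≢ a'
    c≢a' e = a'≢c (sym e)
    c∉p₄ : ∀ y → y ∈ support R₄ → y ≢ c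
    c∉p₄ y y∈ refl = [ c≢d , c≢a' ] (proj₂ (d24 c (proj₂ (redBetween-ends∈ p₂ red₂)) (subst (c ∈_) supp₄ y∈)))
    a'∉p₃ : ∀ y → y ∈ support W₃ → y ≢ a'
    a'∉p₃ y y∈ refl = [ a'≢c , a'≢d ] (proj₂ (d13 a' (proj₁ (path-ends∈ p₁ path₁)) (subst (a' ∈_) supp₃ y∈)))
    glued : Σ (Piece c a' white red) λ M → support M ≡ support W₃ ++ support R₄ ×
              start M ≡ start W₃ × end M ≡ end R₄ × defect M ≡ defect W₃ + defect R₄
    glued = concatPieces W₃ R₄ (meet-supports supp₃ supp₄ (meet-intDisj d34 (shared-end c≢a')))
              (white-red-near (end W₃) (start R₄) (endAt W₃) at₄ (endKind W₃) (startKind R₄)) c∉p₄ a'∉p₃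
    M : Piece c a' white red
    M = proj₁ glued
    suppM' : support M ≡ p₃ ++ p₄
    suppM' = trans (proj₁ (proj₂ glued)) (cong₂ _++_ supp₃ supp₄)
    startM : start M ≡ start W₃
    startM = proj₁ (proj₂ (proj₂ glued))
    endM : end M ≡ end R₄
    endM = proj₁ (proj₂ (proj₂ (proj₂ glued)))
    dM : defect M ≡ defect W₃ + defect R₄
    dM = proj₂ (proj₂ (proj₂ (proj₂ glued)))

lemma5 : {k : ℕ} (S : Setting k) → NoEvenHole (Setting.Adj S) → YSet S →
    (∀ (v : Fin (suc k)) → ¬ ObstructionTo S v) × ¬ AlternatingObstruction S
lemma5 S noEvenHole Ys = no-obstruction-to , no-alternating
  where open Obstructions S Ys noEvenHole
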